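{- For $n\ge 0$ let $a_n=\sum_{\pi\in\mathcal{Q}_{n+1}}2^{\mathrm{des}(\pi)}$. Then for all $n\ge 1$, $$a_n=\sum_{j=1}^{n}\binom{n}{j}a_{n-j}+2^n.$$
   Context: Permutations of $[m]$ are written as words $\pi(1)\cdots\pi(m)$; $\mathrm{des}(\pi)$ is the number of $i\in[m-1]$ with $\pi(i)>\pi(i+1)$. $\mathcal{Q}_m$ denotes the set of permutations $\pi$ of $[m]$ such that $\pi(1)<\pi(2)<\cdots<\pi(p)$ where $p=\pi^{ -1}(m)$ (the identity permutation being included). -}

module Defs where

open import Data.Bool using (Bool; true; false; _∧_; _∨_; not; if_then_else_)
open import Data.Nat using (ℕ; zero; suc; _+_; _*_; _^_; _≡ᵇ_; _<ᵇ_)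
open import Data.List using (List; []; _∷_; map; concatMap; filterᵇ; length; applyUpTo)
open import Data.Bool.ListAction using (and)
open import Data.Nat.ListAction using (sum)

-- Permutations of [m] are represented as words π(1)⋯π(m): lists of naturals.

range1 : ℕ → List ℕ
range1 m = applyUpTo suc m

words : ℕ → ℕ → List (List ℕ)
words zero    m = [] ∷ []
words (suc k) m = concatMap (λ w → map (_∷ w) (range1 m)) (words k m)

occurs : ℕ → List ℕ → Bool
occurs x []      = false
occurs x (y ∷ w) = (x ≡ᵇ y) ∨ occurs x w

-- a word of length m over [1..m] is a permutation iff every i ∈ [1..m] occurs
isPermWord : ℕ → List ℕ → Bool
isPermWord m w = and (map (λ i → occurs i w) (range1 m))

perms : ℕ → List (List ℕ)
perms m = filterᵇ (isPermWord m) (words m m)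

des : List ℕ → ℕ
des []          = 0
des (x ∷ [])    = 0
des (x ∷ y ∷ w) = (if y <ᵇ x then 1 else 0) + des (y ∷ w)

-- π(1) < π(2) < ⋯ < π(p) where π(p) = m : strictly increasing up to the letter m
incUpTo : ℕ → List ℕ → Bool
incUpTo m []          = true
incUpTo m (x ∷ [])    = true
incUpTo m (x ∷ y ∷ w) = (x ≡ᵇ m) ∨ ((x <ᵇ y) ∧ incUpTo m (y ∷ w))

Q : ℕ → List (List ℕ)
Q m = filterᵇ (incUpTo m) (perms m)

a : ℕ → ℕ
a n = sum (map (λ π → 2 ^ des π) (Q (suc n)))

-- Prefix each π ∈ 𝒬_{n+1} with a sentinel letter 0 and build it from left to right. The weighted
-- number of ways to complete a word depends only on how many unused letters lie below its last
-- letter (E, no constraint) or above it while the word still has to climb to the maximum (Φ).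
-- These arrays satisfy explicit recursions, and evaluating them gives a_n + 1 = 2 E(n,n).
-- Pascal's rule for E in its second argument gives E(n,n) = Σ_s C(n,s) E(n−s,0), and together
-- with E(m,m) = 2 E(m,0) for m ≥ 1 this yields Σ_j C(n,j) E(n−j,n−j) + 1 = 2 E(n,n), which is
-- the claimed recurrence after substituting E(k,k) = (a_k + 1)/2.

module Submission where

open import Defs
open import Data.Bool using (Bool; true; false; T; not; _∧_; _∨_; if_then_else_)
open import Data.Bool.ListAction using (and)
open import Data.Bool.Properties using (∧-identityʳ; ∧-zeroʳ)
open import Data.Empty using (⊥-elim)
open import Data.List using (List; []; _∷_; _++_; map; concatMap; filterᵇ; length; applyUpTo)
open import Data.List.Membership.Propositional using (_∈_)
open import Data.List.Membership.Propositional.Properties using (∈-applyUpTo⁺; ∈-applyUpTo⁻)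
open import Data.List.Properties using (map-++; map-∘; map-cong; map-cong-local; length-applyUpTo)
open import Data.List.Relation.Unary.All as All using (All; []; _∷_)
open import Data.List.Relation.Unary.All.Properties as All using ()
open import Data.List.Relation.Unary.AllPairs using (AllPairs; []; _∷_)
open import Data.List.Relation.Unary.AllPairs.Properties as AllPairs using ()
open import Data.List.Relation.Unary.Any using (here; there)
open import Data.Nat using (ℕ; zero; suc; _+_; _*_; _^_; _∸_; _≤_; _<_; _≡ᵇ_; _<ᵇ_; z≤n; s≤s; s≤s⁻¹)
open import Data.Nat.Combinatorics using (_C_; nCk+nC[k+1]≡[n+1]C[k+1]; k>n⇒nCk≡0; nCn≡1)
open import Data.Nat.ListAction using (sum)
open import Data.Nat.ListAction.Properties using (sum-++)
open import Data.Nat.Properties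
open import Data.Nat.Tactic.RingSolver using (solve-∀)
open import Data.Product using (_,_)
open import Data.Sum using (_⊎_; inj₁; inj₂)
open import Function using (_∘_)
open import Relation.Binary.Definitions using (tri<; tri≈; tri>)
open import Relation.Binary.PropositionalEquality
open import Relation.Nullary.Reflects using (ofʸ; ofⁿ)
open ≡-Reasoning
open import Algebra.Properties.CommutativeSemigroup +-commutativeSemigroup using (interchange; x∙yz≈y∙xz)

𝟙 : Bool → ℕ
𝟙 b = if b then 1 else 0

<⇒<ᵇ≡true : ∀ {m n} → m < n → (m <ᵇ n) ≡ true
<⇒<ᵇ≡true {m} {n} m<n with m <ᵇ n | <ᵇ-reflects-< m n
... | true  | _       = refl
... | false | ofⁿ m≮n = ⊥-elim (m≮n m<n)

≥⇒<ᵇ≡false : ∀ {m n} → n ≤ m → (m <ᵇ n) ≡ false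
≥⇒<ᵇ≡false {m} {n} n≤m with m <ᵇ n | <ᵇ-reflects-< m n
... | true  | ofʸ m<n = ⊥-elim (<⇒≱ m<n n≤m)
... | false | _       = refl

≡ᵇ-refl : ∀ n → (n ≡ᵇ n) ≡ true
≡ᵇ-refl zero    = refl
≡ᵇ-refl (suc n) = ≡ᵇ-refl n

≢⇒≡ᵇ≡false : ∀ {m n} → m ≢ n → (m ≡ᵇ n) ≡ false
≢⇒≡ᵇ≡false {m} {n} m≢n with m ≡ᵇ n in eq
... | true  = ⊥-elim (m≢n (≡ᵇ⇒≡ m n (subst T (sym eq) _)))
... | false = refl

<ᵇ≡true⇒< : ∀ {m n} → (m <ᵇ n) ≡ true → m < n
<ᵇ≡true⇒< {m} {n} eq = <ᵇ⇒< m n (subst T (sym eq) _)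

∧-monoʳ : ∀ {a b c} → (b ≡ true → c ≡ true) → (a ∧ b) ≡ true → (a ∧ c) ≡ true
∧-monoʳ {true} b⇒c = b⇒c

𝟙-mono : ∀ {a b} → (a ≡ true → b ≡ true) → 𝟙 a ≤ 𝟙 b
𝟙-mono {false}     _   = z≤n
𝟙-mono {true}  {b} a⇒b rewrite a⇒b refl = ≤-refl

𝟙≤1 : ∀ b → 𝟙 b ≤ 1
𝟙≤1 true  = ≤-refl
𝟙≤1 false = z≤n

∑< : ℕ → (ℕ → ℕ) → ℕ
∑< zero    f = 0
∑< (suc n) f = ∑< n f + f n

infix 6.5 ∑<
syntax ∑< n (λ i → e) = ∑[ i < n ] e

∑<-cong : ∀ n {f g : ℕ → ℕ} → (∀ {i} → i < n → f i ≡ g i) → ∑< n f ≡ ∑< n g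
∑<-cong zero    f≡g = refl
∑<-cong (suc n) f≡g = cong₂ _+_ (∑<-cong n (f≡g ∘ m<n⇒m<1+n)) (f≡g ≤-refl)

∑<-suc : ∀ n f → ∑< (suc n) f ≡ f 0 + ∑< n (f ∘ suc)
∑<-suc zero    f = +-comm 0 (f 0)
∑<-suc (suc n) f = begin
  ∑< (suc n) f + f (suc n)                ≡⟨ cong (_+ f (suc n)) (∑<-suc n f) ⟩
  (f 0 + ∑< n (f ∘ suc)) + f (suc n)     ≡⟨ +-assoc (f 0) _ _ ⟩
  f 0 + ∑< (suc n) (f ∘ suc)             ∎

∑<-+ : ∀ n f g → ∑[ i < n ] (f i + g i) ≡ ∑< n f + ∑< n g
∑<-+ zero    f g = refl
∑<-+ (suc n) f g = begin
  ∑[ i < n ] (f i + g i) + (f n + g n)     ≡⟨ cong (_+ (f n + g n)) (∑<-+ n f g) ⟩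
  (∑< n f + ∑< n g) + (f n + g n)          ≡⟨ interchange (∑< n f) _ _ _ ⟩
  (∑< n f + f n) + (∑< n g + g n)          ∎

∑<-*ˡ : ∀ n c f → ∑[ i < n ] (c * f i) ≡ c * ∑< n f
∑<-*ˡ zero    c f = sym (*-zeroʳ c)
∑<-*ˡ (suc n) c f = trans (cong (_+ c * f n) (∑<-*ˡ n c f)) (sym (*-distribˡ-+ c (∑< n f) (f n)))

∑<-below : ∀ {n j} f → j ≤ n → ∑[ i < n ] (if i <ᵇ j then f i else 0) ≡ ∑< j f
∑<-below {zero}  f z≤n = refl
∑<-below {suc n} {j} f j≤1+n with m≤n⇒m<n∨m≡n j≤1+n
... | inj₁ j<1+n = begin
  ∑[ i < n ] (if i <ᵇ j then f i else 0) + (if n <ᵇ j then f n else 0)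
    ≡⟨ cong (λ b → ∑[ i < n ] (if i <ᵇ j then f i else 0) + (if b then f n else 0)) (≥⇒<ᵇ≡false (s≤s⁻¹ j<1+n)) ⟩
  ∑[ i < n ] (if i <ᵇ j then f i else 0) + 0  ≡⟨ +-identityʳ _ ⟩
  ∑[ i < n ] (if i <ᵇ j then f i else 0)      ≡⟨ ∑<-below f (s≤s⁻¹ j<1+n) ⟩
  ∑< j f                                      ∎
... | inj₂ refl = ∑<-cong (suc n) (λ {i} i<j → cong (λ b → if b then f i else 0) (<⇒<ᵇ≡true i<j))

∑<-Pascal : ∀ r (x : ℕ → ℕ) →
  ∑[ s < suc (suc r) ] (suc r C s) * x s ≡ ∑[ s < suc r ] (r C s) * x s + ∑[ s < suc r ] (r C s) * x (suc s)
∑<-Pascal r x = begin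
  ∑[ s < suc (suc r) ] (suc r C s) * x s
    ≡⟨ ∑<-suc (suc r) _ ⟩
  1 * x 0 + ∑[ s < suc r ] (suc r C suc s) * x (suc s)
    ≡⟨ cong (1 * x 0 +_) (∑<-cong (suc r) λ {s} _ → Pascal s) ⟩
  1 * x 0 + ∑[ s < suc r ] ((r C s) * x (suc s) + (r C suc s) * x (suc s))
    ≡⟨ cong (1 * x 0 +_) (∑<-+ (suc r) _ _) ⟩
  1 * x 0 + (shifted + (inner + (r C suc r) * x (suc r)))
    ≡⟨ cong (λ c → 1 * x 0 + (shifted + (inner + c * x (suc r)))) (k>n⇒nCk≡0 (n<1+n r)) ⟩
  1 * x 0 + (shifted + (inner + 0))
    ≡⟨ rearrange (1 * x 0) shifted inner ⟩
  (1 * x 0 + inner) + shifted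
    ≡⟨ cong (_+ shifted) (sym (∑<-suc r (λ s → (r C s) * x s))) ⟩
  ∑[ s < suc r ] (r C s) * x s + shifted ∎
  where
  shifted inner : ℕ
  shifted = ∑[ s < suc r ] (r C s) * x (suc s)
  inner   = ∑[ s < r ] (r C suc s) * x (suc s)
  Pascal : ∀ s → (suc r C suc s) * x (suc s) ≡ (r C s) * x (suc s) + (r C suc s) * x (suc s)
  Pascal s = trans (cong (_* x (suc s)) (sym (nCk+nC[k+1]≡[n+1]C[k+1] r s)))
                   (*-distribʳ-+ (x (suc s)) (r C s) (r C suc s))
  rearrange : ∀ a p q → a + (p + (q + 0)) ≡ (a + q) + p
  rearrange = solve-∀

∑<-binomial : ∀ n → ∑[ j < suc n ] (n C j) ≡ 2 ^ n
∑<-binomial zero    = refl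
∑<-binomial (suc n) = begin
  ∑[ j < suc (suc n) ] (suc n C j)         ≡⟨ ∑<-cong (suc (suc n)) (λ _ → sym (*-identityʳ _)) ⟩
  ∑[ j < suc (suc n) ] (suc n C j) * 1     ≡⟨ ∑<-Pascal n (λ _ → 1) ⟩
  row + row                                 ≡⟨ cong₂ _+_ row≡2^n row≡2^n ⟩
  2 ^ n + 2 ^ n                             ≡⟨ cong (2 ^ n +_) (sym (+-identityʳ (2 ^ n))) ⟩
  2 ^ suc n                                 ∎
  where
  row : ℕ
  row = ∑[ j < suc n ] (n C j) * 1
  row≡2^n : row ≡ 2 ^ n
  row≡2^n = trans (∑<-cong (suc n) (λ _ → *-identityʳ _)) (∑<-binomial n)

∑<-defect : ∀ K {f g : ℕ → ℕ} → (∀ {t} → t ≤ K → f t + 𝟙 (t ≡ᵇ K) ≡ 2 * g t) →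
            ∀ {j} → j ≤ suc K → ∑< j f + 𝟙 (j ≡ᵇ suc K) ≡ 2 * ∑< j g
∑<-defect K         fg {zero}  _         = refl
∑<-defect K {f} {g} fg {suc j} (s≤s j≤K) = begin
  (∑< j f + f j) + 𝟙 (j ≡ᵇ K)                 ≡⟨ +-assoc (∑< j f) _ _ ⟩
  ∑< j f + (f j + 𝟙 (j ≡ᵇ K))                 ≡⟨ cong₂ _+_ earlier (fg j≤K) ⟩
  2 * ∑< j g + 2 * g j                        ≡⟨ sym (*-distribˡ-+ 2 (∑< j g) (g j)) ⟩
  2 * ∑< (suc j) g                            ∎
  where
  earlier : ∑< j f ≡ 2 * ∑< j g
  earlier = begin
    ∑< j f                        ≡⟨ sym (+-identityʳ _) ⟩
    ∑< j f + 0                    ≡⟨ cong (λ b → ∑< j f + 𝟙 b) (sym (≢⇒≡ᵇ≡false (<⇒≢ (s≤s j≤K)))) ⟩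
    ∑< j f + 𝟙 (j ≡ᵇ suc K)       ≡⟨ ∑<-defect K fg (m≤n⇒m≤1+n j≤K) ⟩
    2 * ∑< j g                    ∎

-- E k r sums 2^des (p ∷ w) over the orderings w of k letters of which r lie below p. Φ k c is
-- the same sum restricted to incUpTo on p ∷ w, when c of the letters, among them the maximum,
-- lie above p; Ψ k t is the part in which the next letter has t of the remaining letters above it.
E : ℕ → ℕ → ℕ
E zero    r = 1
E (suc k) r = ∑[ i < suc k ] 2 ^ 𝟙 (i <ᵇ r) * E k i

mutual
  Φ : ℕ → ℕ → ℕ
  Φ zero    c = 1
  Φ (suc k) c = ∑< c (Ψ k)

  Ψ : ℕ → ℕ → ℕ
  Ψ k zero    = E k k
  Ψ k (suc t) = Φ k (suc t)

E-suc : ∀ k {r} → r ≤ suc k → E (suc k) r ≡ ∑< (suc k) (E k) + ∑< r (E k)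
E-suc k {r} r≤1+k = begin
  ∑[ i < suc k ] 2 ^ 𝟙 (i <ᵇ r) * E k i
    ≡⟨ ∑<-cong (suc k) (λ {i} _ → doubled-if (i <ᵇ r) (E k i)) ⟩
  ∑[ i < suc k ] (E k i + (if i <ᵇ r then E k i else 0))
    ≡⟨ ∑<-+ (suc k) (E k) _ ⟩
  ∑< (suc k) (E k) + ∑[ i < suc k ] (if i <ᵇ r then E k i else 0)
    ≡⟨ cong (∑< (suc k) (E k) +_) (∑<-below (E k) r≤1+k) ⟩
  ∑< (suc k) (E k) + ∑< r (E k) ∎
  where
  doubled-if : ∀ b y → 2 ^ 𝟙 b * y ≡ y + (if b then y else 0)
  doubled-if true  y = cong (y +_) (+-identityʳ y)
  doubled-if false y = trans (+-identityʳ y) (sym (+-identityʳ y))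

E-suc-suc : ∀ {k r} → r ≤ k → E (suc k) (suc r) ≡ E (suc k) r + E k r
E-suc-suc {k} {r} r≤k = begin
  E (suc k) (suc r)                          ≡⟨ E-suc k (s≤s r≤k) ⟩
  ∑< (suc k) (E k) + (∑< r (E k) + E k r)    ≡⟨ sym (+-assoc (∑< (suc k) (E k)) _ _) ⟩
  (∑< (suc k) (E k) + ∑< r (E k)) + E k r    ≡⟨ cong (_+ E k r) (sym (E-suc k (m≤n⇒m≤1+n r≤k))) ⟩
  E (suc k) r + E k r                        ∎

E-binomial : ∀ {r k} → r ≤ k → E k r ≡ ∑[ s < suc r ] (r C s) * E (k ∸ s) 0
E-binomial {zero}  {k}     _         = sym (+-identityʳ (E k 0))
E-binomial {suc r} {suc k} (s≤s r≤k) = begin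
  E (suc k) (suc r)                          ≡⟨ E-suc-suc r≤k ⟩
  E (suc k) r + E k r                        ≡⟨ cong₂ _+_ (E-binomial (m≤n⇒m≤1+n r≤k)) (E-binomial r≤k) ⟩
  ∑[ s < suc r ] (r C s) * E (suc k ∸ s) 0 + ∑[ s < suc r ] (r C s) * E (k ∸ s) 0
                                             ≡⟨ sym (∑<-Pascal r (λ s → E (suc k ∸ s) 0)) ⟩
  ∑[ s < suc (suc r) ] (suc r C s) * E (suc k ∸ s) 0 ∎

E-diag : ∀ {m} → 0 < m → E m m ≡ 2 * E m 0
E-diag {suc k} _ = begin
  E (suc k) (suc k)      ≡⟨ E-suc k ≤-refl ⟩
  total + total          ≡⟨ cong (total +_) (sym (+-identityʳ total)) ⟩
  2 * total              ≡⟨ cong (2 *_) (sym (trans (E-suc k z≤n) (+-identityʳ total))) ⟩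
  2 * E (suc k) 0        ∎
  where
  total : ℕ
  total = ∑< (suc k) (E k)

E-diag-binomial : ∀ n → ∑[ j < suc n ] (n C j) * E (n ∸ j) (n ∸ j) + 1 ≡ 2 * E n n
E-diag-binomial n = begin
  ∑[ j < suc n ] (n C j) * E (n ∸ j) (n ∸ j) + 1
    ≡⟨ cong (λ b → ∑[ j < suc n ] (n C j) * E (n ∸ j) (n ∸ j) + 𝟙 b) (sym (≡ᵇ-refl n)) ⟩
  ∑[ j < suc n ] (n C j) * E (n ∸ j) (n ∸ j) + 𝟙 (suc n ≡ᵇ suc n)
    ≡⟨ ∑<-defect n term ≤-refl ⟩
  2 * (∑[ j < suc n ] (n C j) * E (n ∸ j) 0)
    ≡⟨ cong (2 *_) (sym (E-binomial {n} ≤-refl)) ⟩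
  2 * E n n ∎
  where
  term : ∀ {j} → j ≤ n → (n C j) * E (n ∸ j) (n ∸ j) + 𝟙 (j ≡ᵇ n) ≡ 2 * ((n C j) * E (n ∸ j) 0)
  term {j} j≤n with m≤n⇒m<n∨m≡n j≤n
  ... | inj₂ refl rewrite nCn≡1 j | n∸n≡0 j | ≡ᵇ-refl j = refl
  ... | inj₁ j<n  = begin
    (n C j) * E (n ∸ j) (n ∸ j) + 𝟙 (j ≡ᵇ n)
      ≡⟨ cong₂ (λ e b → (n C j) * e + 𝟙 b) (E-diag (m<n⇒0<n∸m j<n)) (≢⇒≡ᵇ≡false (<⇒≢ j<n)) ⟩
    (n C j) * (2 * E (n ∸ j) 0) + 0           ≡⟨ swap (n C j) (E (n ∸ j) 0) ⟩
    2 * ((n C j) * E (n ∸ j) 0)               ∎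
    where
    swap : ∀ c e → c * (2 * e) + 0 ≡ 2 * (c * e)
    swap = solve-∀

Φ-suc : ∀ {k j} → j ≤ k → Φ (suc k) (suc j) + 𝟙 (j ≡ᵇ k) ≡ 2 * E k j
Φ-suc {zero}  {zero}  z≤n = refl
Φ-suc {suc k} {j}     j≤1+k = begin
  Φ (suc (suc k)) (suc j) + 𝟙 (j ≡ᵇ suc k)
    ≡⟨ cong (_+ 𝟙 (j ≡ᵇ suc k)) (∑<-suc j (Ψ (suc k))) ⟩
  (E (suc k) (suc k) + ∑[ t < j ] Φ (suc k) (suc t)) + 𝟙 (j ≡ᵇ suc k)
    ≡⟨ +-assoc (E (suc k) (suc k)) _ _ ⟩
  E (suc k) (suc k) + (∑[ t < j ] Φ (suc k) (suc t) + 𝟙 (j ≡ᵇ suc k))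
    ≡⟨ cong₂ _+_ (E-suc k ≤-refl) (∑<-defect k {λ t → Φ (suc k) (suc t)} {E k} Φ-suc j≤1+k) ⟩
  (total + total) + 2 * ∑< j (E k)
    ≡⟨ cong (λ t → (total + t) + 2 * ∑< j (E k)) (sym (+-identityʳ total)) ⟩
  2 * total + 2 * ∑< j (E k)
    ≡⟨ sym (*-distribˡ-+ 2 total _) ⟩
  2 * (total + ∑< j (E k))
    ≡⟨ cong (2 *_) (sym (E-suc k j≤1+k)) ⟩
  2 * E (suc k) j ∎
  where
  total : ℕ
  total = ∑< (suc k) (E k)

Φ-diag : ∀ n → Φ (suc n) (suc n) + 1 ≡ 2 * E n n
Φ-diag n = trans (cong (λ b → Φ (suc n) (suc n) + 𝟙 b) (sym (≡ᵇ-refl n))) (Φ-suc {n} ≤-refl)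

Φ≡Ψ : ∀ k {c} → 0 < c → Φ k c ≡ Ψ k c
Φ≡Ψ k {suc t} _ = refl

binomial-recurrence : (b g : ℕ → ℕ) → (∀ k → b k + 1 ≡ 2 * g k) →
                      (∀ n → ∑[ j < suc n ] (n C j) * g (n ∸ j) + 1 ≡ 2 * g n) →
                      ∀ n → b n ≡ ∑[ j < n ] (n C suc j) * b (n ∸ suc j) + 2 ^ n
binomial-recurrence b g b+1≡2g g-rec n = +-cancelˡ-≡ (b n) _ _ (sym (begin
  b n + (tail + 2 ^ n)                                        ≡⟨ sym (+-assoc (b n) tail (2 ^ n)) ⟩
  (b n + tail) + 2 ^ n                                        ≡⟨ cong (λ x → (x + tail) + 2 ^ n) (sym (*-identityˡ (b n))) ⟩
  (1 * b n + tail) + 2 ^ n                                    ≡⟨ cong₂ _+_ (sym (∑<-suc n _)) (sym (∑<-binomial n)) ⟩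
  ∑[ j < suc n ] (n C j) * b (n ∸ j) + ∑[ j < suc n ] (n C j) ≡⟨ sym (∑<-+ (suc n) _ _) ⟩
  ∑[ j < suc n ] ((n C j) * b (n ∸ j) + n C j)                ≡⟨ ∑<-cong (suc n) (λ {j} _ → term j) ⟩
  ∑[ j < suc n ] 2 * ((n C j) * g (n ∸ j))                    ≡⟨ ∑<-*ˡ (suc n) 2 _ ⟩
  2 * (∑[ j < suc n ] (n C j) * g (n ∸ j))                    ≡⟨ cong (2 *_) (+-cancelʳ-≡ 1 _ _ (trans (g-rec n) (sym (b+1≡2g n)))) ⟩
  2 * b n                                                     ≡⟨ cong (b n +_) (+-identityʳ (b n)) ⟩
  b n + b n                                                   ∎))
  where
  tail : ℕ
  tail = ∑[ j < n ] (n C suc j) * b (n ∸ suc j)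
  term : ∀ j → (n C j) * b (n ∸ j) + n C j ≡ 2 * ((n C j) * g (n ∸ j))
  term j = begin
    (n C j) * b (n ∸ j) + n C j        ≡⟨ cong ((n C j) * b (n ∸ j) +_) (sym (*-identityʳ (n C j))) ⟩
    (n C j) * b (n ∸ j) + (n C j) * 1  ≡⟨ sym (*-distribˡ-+ (n C j) (b (n ∸ j)) 1) ⟩
    (n C j) * (b (n ∸ j) + 1)          ≡⟨ cong ((n C j) *_) (b+1≡2g (n ∸ j)) ⟩
    (n C j) * (2 * g (n ∸ j))          ≡⟨ *-comm-2 (n C j) (g (n ∸ j)) ⟩
    2 * ((n C j) * g (n ∸ j))          ∎
    where
    *-comm-2 : ∀ c x → c * (2 * x) ≡ 2 * (c * x)
    *-comm-2 = solve-∀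

private variable A B : Set

sum-map-cong : ∀ {f g : A → ℕ} xs → (∀ {x} → x ∈ xs → f x ≡ g x) → sum (map f xs) ≡ sum (map g xs)
sum-map-cong xs f≡g = cong sum (map-cong-local (All.tabulate f≡g))

sum-map-+ : ∀ (f g : A → ℕ) xs → sum (map (λ x → f x + g x) xs) ≡ sum (map f xs) + sum (map g xs)
sum-map-+ f g []       = refl
sum-map-+ f g (x ∷ xs) = trans (cong (f x + g x +_) (sum-map-+ f g xs)) (interchange (f x) (g x) _ _)

sum-map-*ˡ : ∀ c (f : A → ℕ) xs → sum (map (λ x → c * f x) xs) ≡ c * sum (map f xs)
sum-map-*ˡ c f []       = sym (*-zeroʳ c)
sum-map-*ˡ c f (x ∷ xs) = trans (cong (c * f x +_) (sum-map-*ˡ c f xs)) (sym (*-distribˡ-+ c (f x) _))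

sum-map-zero : ∀ (xs : List A) → sum (map (λ _ → 0) xs) ≡ 0
sum-map-zero = sum-map-*ˡ 0 (λ _ → 0)

sum-map-filterᵇ : ∀ (p : A → Bool) (f : A → ℕ) xs →
                  sum (map f (filterᵇ p xs)) ≡ sum (map (λ x → if p x then f x else 0) xs)
sum-map-filterᵇ p f []       = refl
sum-map-filterᵇ p f (x ∷ xs) with p x
... | true  = cong (f x +_) (sum-map-filterᵇ p f xs)
... | false = sum-map-filterᵇ p f xs

sum-map-swap : ∀ (h : A → B → ℕ) xs ys →
               sum (map (λ x → sum (map (h x) ys)) xs) ≡ sum (map (λ y → sum (map (λ x → h x y) xs)) ys)
sum-map-swap h []       ys = sym (sum-map-zero ys)
sum-map-swap h (x ∷ xs) ys = trans (cong (sum (map (h x) ys) +_) (sum-map-swap h xs ys))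
                                   (sym (sum-map-+ (h x) _ ys))

sum-map-concatMap : ∀ (g : A → List B) (f : B → ℕ) xs →
                    sum (map f (concatMap g xs)) ≡ sum (map (λ x → sum (map f (g x))) xs)
sum-map-concatMap g f []       = refl
sum-map-concatMap g f (x ∷ xs) = begin
  sum (map f (g x ++ concatMap g xs))                  ≡⟨ cong sum (map-++ f (g x) _) ⟩
  sum (map f (g x) ++ map f (concatMap g xs))          ≡⟨ sum-++ (map f (g x)) _ ⟩
  sum (map f (g x)) + sum (map f (concatMap g xs))     ≡⟨ cong (sum (map f (g x)) +_) (sum-map-concatMap g f xs) ⟩
  sum (map f (g x)) + sum (map (λ x → sum (map f (g x))) xs) ∎

sum-map-applyUpTo : ∀ (h f : ℕ → ℕ) n → sum (map h (applyUpTo f n)) ≡ ∑< n (h ∘ f)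
sum-map-applyUpTo h f zero    = refl
sum-map-applyUpTo h f (suc n) = trans (cong (h (f 0) +_) (sum-map-applyUpTo h (f ∘ suc) n)) (sym (∑<-suc n (h ∘ f)))

count : List ℕ → (ℕ → Bool) → ℕ
count L q = sum (map (𝟙 ∘ q) L)

count-cong : ∀ L {q q′ : ℕ → Bool} → (∀ {y} → y ∈ L → q y ≡ q′ y) → count L q ≡ count L q′
count-cong L q≡q′ = sum-map-cong L (cong 𝟙 ∘ q≡q′)

count-mono : ∀ L {q q′ : ℕ → Bool} → (∀ {y} → q y ≡ true → q′ y ≡ true) → count L q ≤ count L q′
count-mono []      q⇒q′ = z≤n
count-mono (y ∷ L) q⇒q′ = +-mono-≤ (𝟙-mono q⇒q′) (count-mono L q⇒q′)

count-< : ∀ {L x} {q q′ : ℕ → Bool} → (∀ {y} → q y ≡ true → q′ y ≡ true) →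
          x ∈ L → q x ≡ false → q′ x ≡ true → count L q < count L q′
count-< {y ∷ L} {q = q} {q′} q⇒q′ (here refl) qx q′x rewrite qx | q′x = s≤s (count-mono L q⇒q′)
count-< {y ∷ L}             q⇒q′ (there x∈L)  qx q′x = +-mono-≤-< (𝟙-mono q⇒q′) (count-< q⇒q′ x∈L qx q′x)

count-pos : ∀ {L x} {q : ℕ → Bool} → x ∈ L → q x ≡ true → 0 < count L q
count-pos {q = q} (here refl) qx rewrite qx = s≤s z≤n
count-pos {y ∷ L} {q = q} (there x∈L) qx = ≤-trans (count-pos x∈L qx) (m≤n+m _ (𝟙 (q y)))

count-all : ∀ {L} {q : ℕ → Bool} → All (λ y → q y ≡ true) L → count L q ≡ length L
count-all []         = refl
count-all (qy ∷ qL) rewrite qy = cong suc (count-all qL)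

count-none : ∀ {L} {q : ℕ → Bool} → All (λ y → q y ≡ false) L → count L q ≡ 0
count-none []         = refl
count-none (qy ∷ qL) rewrite qy = count-none qL

_─_ : (ℕ → Bool) → ℕ → ℕ → Bool
(S ─ x) y = S y ∧ not (y ≡ᵇ x)

─-self : ∀ S x → (S ─ x) x ≡ false
─-self S x rewrite ≡ᵇ-refl x = ∧-zeroʳ (S x)

─-≢ : ∀ S {x y} → y ≢ x → (S ─ x) y ≡ S y
─-≢ S {x} {y} y≢x rewrite ≢⇒≡ᵇ≡false y≢x = ∧-identityʳ (S y)

─-∧ : ∀ S {x y} b → (b ≡ true → y ≢ x) → ((S ─ x) y ∧ b) ≡ (S y ∧ b)
─-∧ S {x} {y} false _   = trans (∧-zeroʳ _) (sym (∧-zeroʳ (S y)))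
─-∧ S {x} {y} true  y≢x = cong (_∧ true) (─-≢ S (y≢x refl))

count-─ : ∀ {L x} S → AllPairs _<_ L → x ∈ L → count L S ≡ 𝟙 (S x) + count L (S ─ x)
count-─ {y ∷ L} S (y<L ∷ _) (here refl) rewrite ─-self S y =
  cong (𝟙 (S y) +_) (count-cong L (λ z∈L → sym (─-≢ S (>⇒≢ (All.lookup y<L z∈L)))))
count-─ {y ∷ L} {x} S (y<L ∷ sorted) (there x∈L) = begin
  𝟙 (S y) + count L S                          ≡⟨ cong (𝟙 (S y) +_) (count-─ S sorted x∈L) ⟩
  𝟙 (S y) + (𝟙 (S x) + count L (S ─ x))        ≡⟨ x∙yz≈y∙xz (𝟙 (S y)) (𝟙 (S x)) _ ⟩
  𝟙 (S x) + (𝟙 (S y) + count L (S ─ x))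
    ≡⟨ cong (λ b → 𝟙 (S x) + (𝟙 b + count L (S ─ x))) (sym (─-≢ S (<⇒≢ (All.lookup y<L x∈L)))) ⟩
  𝟙 (S x) + count (y ∷ L) (S ─ x)              ∎

rank corank : List ℕ → (ℕ → Bool) → ℕ → ℕ
rank   L S b = count L (λ y → S y ∧ (y <ᵇ b))
corank L S b = count L (λ y → S y ∧ (b <ᵇ y))

rank-─ : ∀ L S x → rank L (S ─ x) x ≡ rank L S x
rank-─ L S x = count-cong L (λ {y} _ → ─-∧ S (y <ᵇ x) (<⇒≢ ∘ <ᵇ≡true⇒<))

corank-─ : ∀ L S x → corank L (S ─ x) x ≡ corank L S x
corank-─ L S x = count-cong L (λ {y} _ → ─-∧ S (x <ᵇ y) (>⇒≢ ∘ <ᵇ≡true⇒<))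

rank-mono : ∀ L S {a b} → a ≤ b → rank L S a ≤ rank L S b
rank-mono L S a≤b = count-mono L (∧-monoʳ (λ y<a → <⇒<ᵇ≡true (<-≤-trans (<ᵇ≡true⇒< y<a) a≤b)))

rank-<ᵇ : ∀ {L} S {x p} → x ∈ L → S x ≡ true → S p ≡ false → (x <ᵇ p) ≡ (rank L S x <ᵇ rank L S p)
rank-<ᵇ {L} S {x} {p} x∈L Sx Sp with <-cmp x p
... | tri< x<p _ _ = trans (<⇒<ᵇ≡true x<p) (sym (<⇒<ᵇ≡true (count-< below-x⇒below-p x∈L x-not-below-x x-below-p)))
  where
  below-x⇒below-p : ∀ {y} → (S y ∧ (y <ᵇ x)) ≡ true → (S y ∧ (y <ᵇ p)) ≡ true
  below-x⇒below-p = ∧-monoʳ (λ y<x → <⇒<ᵇ≡true (<-trans (<ᵇ≡true⇒< y<x) x<p))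
  x-not-below-x : (S x ∧ (x <ᵇ x)) ≡ false
  x-not-below-x = trans (cong (S x ∧_) (≥⇒<ᵇ≡false {x} ≤-refl)) (∧-zeroʳ (S x))
  x-below-p : (S x ∧ (x <ᵇ p)) ≡ true
  x-below-p rewrite Sx = <⇒<ᵇ≡true x<p
... | tri≈ _ refl _ = ⊥-elim (true≢false (trans (sym Sx) Sp))
  where true≢false : true ≢ false
        true≢false ()
... | tri> _ _ p<x = trans (≥⇒<ᵇ≡false (<⇒≤ p<x)) (sym (≥⇒<ᵇ≡false (rank-mono L S (<⇒≤ p<x))))

rank-top : ∀ {L m} S → All (_≤ m) L → S m ≡ false → rank L S m ≡ count L S
rank-top {L} {m} S L≤m Sm = count-cong L λ y∈L → below-top (m≤n⇒m<n∨m≡n (All.lookup L≤m y∈L))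
  where
  below-top : ∀ {y} → y < m ⊎ y ≡ m → (S y ∧ (y <ᵇ m)) ≡ S y
  below-top {y} (inj₁ y<m) = trans (cong (S y ∧_) (<⇒<ᵇ≡true y<m)) (∧-identityʳ (S y))
  below-top     (inj₂ refl) = trans (cong (S m ∧_) (≥⇒<ᵇ≡false {m} ≤-refl)) (trans (∧-zeroʳ (S m)) (sym Sm))

corank-top : ∀ {L m} S → All (_≤ m) L → corank L S m ≡ 0
corank-top S L≤m = count-none (All.map (λ {y} y≤m → trans (cong (S y ∧_) (≥⇒<ᵇ≡false y≤m)) (∧-zeroʳ (S y))) L≤m)

corank-below : ∀ {L c} S → All (c <_) L → corank L S c ≡ count L S
corank-below {L} S c<L = count-cong L (λ {y} y∈L → trans (cong (S y ∧_) (<⇒<ᵇ≡true (All.lookup c<L y∈L))) (∧-identityʳ (S y)))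

corank-pos : ∀ {L m x} S → m ∈ L → S m ≡ true → x < m → 0 < corank L S x
corank-pos {m = m} S m∈L Sm x<m = count-pos m∈L (trans (cong (S m ∧_) (<⇒<ᵇ≡true x<m)) (trans (∧-identityʳ (S m)) Sm))

sum-map-rank : ∀ {L} S (f : ℕ → ℕ) → AllPairs _<_ L →
         sum (map (λ x → if S x then f (rank L S x) else 0) L) ≡ ∑< (count L S) f
sum-map-rank {[]}    S f []              = refl
sum-map-rank {y ∷ L} S f (y<L ∷ sorted) = begin
  (if S y then f (rank (y ∷ L) S y) else 0) + sum (map (λ x → if S x then f (rank (y ∷ L) S x) else 0) L)
    ≡⟨ cong₂ _+_ (cong (λ r → if S y then f r else 0) rank-y) (trans (sum-map-cong L rank-L) (sum-map-rank S f′ sorted)) ⟩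
  (if S y then f 0 else 0) + ∑< (count L S) f′
    ≡⟨ prepend (S y) ⟩
  ∑< (𝟙 (S y) + count L S) f ∎
  where
  f′ : ℕ → ℕ
  f′ t = f (𝟙 (S y) + t)
  not-below : ∀ {z} → y ≤ z → (S z ∧ (z <ᵇ y)) ≡ false
  not-below {z} y≤z = trans (cong (S z ∧_) (≥⇒<ᵇ≡false y≤z)) (∧-zeroʳ (S z))
  rank-y : rank (y ∷ L) S y ≡ 0
  rank-y = cong₂ _+_ (cong 𝟙 (not-below ≤-refl)) (count-none (All.map (not-below ∘ <⇒≤) y<L))
  rank-L : ∀ {x} → x ∈ L → (if S x then f (rank (y ∷ L) S x) else 0) ≡ (if S x then f′ (rank L S x) else 0)
  rank-L {x} x∈L = cong (λ b → if S x then f (𝟙 b + rank L S x) else 0)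
                        (trans (cong (S y ∧_) (<⇒<ᵇ≡true (All.lookup y<L x∈L))) (∧-identityʳ (S y)))
  prepend : ∀ b → (if b then f 0 else 0) + ∑< (count L S) (λ t → f (𝟙 b + t)) ≡ ∑< (𝟙 b + count L S) f
  prepend true  = sym (∑<-suc (count L S) f)
  prepend false = refl

sum-map-corank : ∀ {L} S b (f : ℕ → ℕ) → AllPairs _<_ L →
           sum (map (λ x → if S x ∧ (b <ᵇ x) then f (corank L S x) else 0) L) ≡ ∑< (corank L S b) f
sum-map-corank {[]}    S b f []              = refl
sum-map-corank {y ∷ L} S b f (y<L ∷ sorted) = begin
  (if S y ∧ (b <ᵇ y) then f (corank (y ∷ L) S y) else 0)
    + sum (map (λ x → if S x ∧ (b <ᵇ x) then f (corank (y ∷ L) S x) else 0) L)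
    ≡⟨ cong₂ _+_ (cong (λ c → if S y ∧ (b <ᵇ y) then f c else 0) corank-y)
                 (trans (sum-map-cong L corank-L) (sum-map-corank S b f sorted)) ⟩
  (if S y ∧ (b <ᵇ y) then f (count L S) else 0) + ∑< (corank L S b) f
    ≡⟨ append (S y ∧ (b <ᵇ y)) (λ b<y → corank-below S (All.map (<-trans (<ᵇ≡true⇒< (∧-snd (S y) b<y))) y<L)) ⟩
  ∑< (𝟙 (S y ∧ (b <ᵇ y)) + corank L S b) f ∎
  where
  ∧-snd : ∀ a {c} → (a ∧ c) ≡ true → c ≡ true
  ∧-snd true c = c
  not-above : ∀ {z} → y ≤ z → (S y ∧ (z <ᵇ y)) ≡ false
  not-above y≤z = trans (cong (S y ∧_) (≥⇒<ᵇ≡false y≤z)) (∧-zeroʳ (S y))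
  corank-y : corank (y ∷ L) S y ≡ count L S
  corank-y = cong₂ _+_ (cong 𝟙 (not-above ≤-refl)) (corank-below S y<L)
  corank-L : ∀ {x} → x ∈ L → (if S x ∧ (b <ᵇ x) then f (corank (y ∷ L) S x) else 0)
                           ≡ (if S x ∧ (b <ᵇ x) then f (corank L S x) else 0)
  corank-L {x} x∈L = cong (λ c → if S x ∧ (b <ᵇ x) then f (𝟙 c + corank L S x) else 0)
                          (not-above (<⇒≤ (All.lookup y<L x∈L)))
  append : ∀ c → (c ≡ true → corank L S b ≡ count L S) →
           (if c then f (count L S) else 0) + ∑< (corank L S b) f ≡ ∑< (𝟙 c + corank L S b) f
  append true  above rewrite above refl = +-comm (f (count L S)) _
  append false _     = refl

∑words : ℕ → List ℕ → (List ℕ → ℕ) → ℕ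
∑words zero    L G = G []
∑words (suc k) L G = sum (map (λ x → ∑words k L (G ∘ (x ∷_))) L)

∑words-cong : ∀ k L {G G′ : List ℕ → ℕ} → (∀ w → G w ≡ G′ w) → ∑words k L G ≡ ∑words k L G′
∑words-cong zero    L G≡G′ = G≡G′ []
∑words-cong (suc k) L G≡G′ = sum-map-cong L (λ {x} _ → ∑words-cong k L (G≡G′ ∘ (x ∷_)))

∑words-sum : ∀ k L (M : List ℕ) (H : ℕ → List ℕ → ℕ) →
             ∑words k L (λ w → sum (map (λ y → H y w) M)) ≡ sum (map (λ y → ∑words k L (H y)) M)
∑words-sum zero    L M H = refl
∑words-sum (suc k) L M H = begin
  sum (map (λ x → ∑words k L (λ w → sum (map (λ y → H y (x ∷ w)) M))) L)
    ≡⟨ sum-map-cong L (λ {x} _ → ∑words-sum k L M (λ y w → H y (x ∷ w))) ⟩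
  sum (map (λ x → sum (map (λ y → ∑words k L (H y ∘ (x ∷_))) M)) L)
    ≡⟨ sum-map-swap (λ x y → ∑words k L (H y ∘ (x ∷_))) L M ⟩
  sum (map (λ y → ∑words (suc k) L (H y)) M) ∎

sum-words : ∀ k m (G : List ℕ → ℕ) → sum (map G (words k m)) ≡ ∑words k (range1 m) G
sum-words zero    m G = +-identityʳ (G [])
sum-words (suc k) m G = begin
  sum (map G (concatMap (λ w → map (_∷ w) (range1 m)) (words k m)))
    ≡⟨ sum-map-concatMap _ G (words k m) ⟩
  sum (map (λ w → sum (map G (map (_∷ w) (range1 m)))) (words k m))
    ≡⟨ sum-map-cong (words k m) (λ {w} _ → cong sum (sym (map-∘ (range1 m)))) ⟩
  sum (map (λ w → sum (map (λ x → G (x ∷ w)) (range1 m))) (words k m))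
    ≡⟨ sum-words k m _ ⟩
  ∑words k (range1 m) (λ w → sum (map (λ x → G (x ∷ w)) (range1 m)))
    ≡⟨ ∑words-sum k (range1 m) (range1 m) (λ x w → G (x ∷ w)) ⟩
  ∑words (suc k) (range1 m) G ∎

-- isPermWord m is definitionally covers (range1 m) (λ _ → true).
covers : List ℕ → (ℕ → Bool) → List ℕ → Bool
covers L S w = and (map (λ i → not (S i) ∨ occurs i w) L)

covers-∷ : ∀ L S x w → covers L S (x ∷ w) ≡ covers L (S ─ x) w
covers-∷ L S x w = cong and (map-cong (λ i → not-∨-∨ (S i) (i ≡ᵇ x) (occurs i w)) L)
  where
  not-∨-∨ : ∀ a b c → (not a ∨ (b ∨ c)) ≡ (not (a ∧ not b) ∨ c)
  not-∨-∨ true  true  c = refl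
  not-∨-∨ true  false c = refl
  not-∨-∨ false b     c = refl

covers-[] : ∀ L S → covers L S [] ≡ (count L S ≡ᵇ 0)
covers-[] []      S = refl
covers-[] (y ∷ L) S with S y
... | true  = refl
... | false = covers-[] L S

∑perm : List ℕ → ℕ → (ℕ → Bool) → (List ℕ → ℕ) → ℕ
∑perm L zero    S G = G []
∑perm L (suc k) S G = sum (map (λ x → if S x then ∑perm L k (S ─ x) (G ∘ (x ∷_)) else 0) L)

∑perm-cong : ∀ L k S {G G′ : List ℕ → ℕ} → (∀ w → G w ≡ G′ w) → ∑perm L k S G ≡ ∑perm L k S G′
∑perm-cong L zero    S G≡G′ = G≡G′ []
∑perm-cong L (suc k) S G≡G′ =
  sum-map-cong L (λ {x} _ → cong (λ t → if S x then t else 0) (∑perm-cong L k (S ─ x) (G≡G′ ∘ (x ∷_))))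

∑perm-*ˡ : ∀ L k S c (G : List ℕ → ℕ) → ∑perm L k S (λ w → c * G w) ≡ c * ∑perm L k S G
∑perm-*ˡ L zero    S c G = refl
∑perm-*ˡ L (suc k) S c G = trans (sum-map-cong L (λ {x} _ → pull x)) (sum-map-*ˡ c _ L)
  where
  pull : ∀ x → (if S x then ∑perm L k (S ─ x) (λ w → c * G (x ∷ w)) else 0)
             ≡ c * (if S x then ∑perm L k (S ─ x) (G ∘ (x ∷_)) else 0)
  pull x with S x
  ... | true  = ∑perm-*ˡ L k (S ─ x) c (G ∘ (x ∷_))
  ... | false = sym (*-zeroʳ c)

∑perm-zero : ∀ L k S → ∑perm L k S (λ _ → 0) ≡ 0
∑perm-zero L k S = ∑perm-*ˡ L k S 0 (λ _ → 0)

climbWeight : ℕ → ℕ → List ℕ → ℕ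
climbWeight m p w = if incUpTo m (p ∷ w) then 2 ^ des (p ∷ w) else 0

climbWeight-top : ∀ m w → climbWeight m m w ≡ 2 ^ des (m ∷ w)
climbWeight-top m []      = refl
climbWeight-top m (_ ∷ _) rewrite ≡ᵇ-refl m = refl

climbWeight-descent : ∀ {m p x} w → p < m → (p <ᵇ x) ≡ false → climbWeight m p (x ∷ w) ≡ 0
climbWeight-descent w p<m p≮x rewrite ≢⇒≡ᵇ≡false (<⇒≢ p<m) | p≮x = refl

climbWeight-ascent : ∀ {m p x} w → p < m → (p <ᵇ x) ≡ true → climbWeight m p (x ∷ w) ≡ climbWeight m x w
climbWeight-ascent {x = x} w p<m p<ᵇx
  rewrite ≢⇒≡ᵇ≡false (<⇒≢ p<m) | p<ᵇx | ≥⇒<ᵇ≡false {x} (<⇒≤ (<ᵇ≡true⇒< p<ᵇx)) = refl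

module _ {L : List ℕ} (sorted : AllPairs _<_ L) where

  private
    covering-∷ : ∀ S x (G : List ℕ → ℕ) w →
                 (if covers L S (x ∷ w) then G (x ∷ w) else 0) ≡ (if covers L (S ─ x) w then G (x ∷ w) else 0)
    covering-∷ S x G w = cong (λ b → if b then G (x ∷ w) else 0) (covers-∷ L S x w)

    count-─-at : ∀ S {x b} → x ∈ L → S x ≡ b → count L S ≡ 𝟙 b + count L (S ─ x)
    count-─-at S x∈L Sx≡b = trans (count-─ S sorted x∈L) (cong (λ b → 𝟙 b + _) Sx≡b)

  ∑words-covering-short : ∀ k S (G : List ℕ → ℕ) → k < count L S →
                          ∑words k L (λ w → if covers L S w then G w else 0) ≡ 0
  ∑words-covering-short zero    S G 0<count =
    cong (λ b → if b then G [] else 0) (trans (covers-[] L S) (≢⇒≡ᵇ≡false (>⇒≢ 0<count)))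
  ∑words-covering-short (suc k) S G k<count = trans (sum-map-cong L step) (sum-map-zero L)
    where
    step : ∀ {x} → x ∈ L → ∑words k L (λ w → if covers L S (x ∷ w) then G (x ∷ w) else 0) ≡ 0
    step {x} x∈L = trans (∑words-cong k L (covering-∷ S x G))
                         (∑words-covering-short k (S ─ x) (G ∘ (x ∷_))
                           (s≤s⁻¹ (<-≤-trans k<count (≤-trans (≤-reflexive (count-─ S sorted x∈L))
                                                              (+-monoˡ-≤ _ (𝟙≤1 (S x)))))))

  ∑words-covering : ∀ k S (G : List ℕ → ℕ) → count L S ≡ k →
                    ∑words k L (λ w → if covers L S w then G w else 0) ≡ ∑perm L k S G
  ∑words-covering zero    S G count≡0 =
    cong (λ b → if b then G [] else 0) (trans (covers-[] L S) (cong (_≡ᵇ 0) count≡0))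
  ∑words-covering (suc k) S G count≡1+k = sum-map-cong L λ {x} x∈L →
    trans (∑words-cong k L (covering-∷ S x G)) (step x∈L)
    where
    step : ∀ {x} → x ∈ L → ∑words k L (λ w → if covers L (S ─ x) w then G (x ∷ w) else 0)
                          ≡ (if S x then ∑perm L k (S ─ x) (G ∘ (x ∷_)) else 0)
    step {x} x∈L with S x in Sx
    ... | true  = ∑words-covering k (S ─ x) (G ∘ (x ∷_))
                    (suc-injective (trans (sym (count-─-at S x∈L Sx)) count≡1+k))
    ... | false = ∑words-covering-short k (S ─ x) (G ∘ (x ∷_))
                    (≤-reflexive (sym (trans (sym (count-─-at S x∈L Sx)) count≡1+k)))

  ∑perm-des : ∀ k S p → count L S ≡ k → S p ≡ false →
              ∑perm L k S (λ w → 2 ^ des (p ∷ w)) ≡ E k (rank L S p)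
  ∑perm-des zero    S p _         _  = refl
  ∑perm-des (suc k) S p count≡1+k Sp = begin
    sum (map (λ x → if S x then ∑perm L k (S ─ x) (λ w → 2 ^ des (p ∷ x ∷ w)) else 0) L)
      ≡⟨ sum-map-cong L step ⟩
    sum (map (λ x → if S x then f (rank L S x) else 0) L)
      ≡⟨ sum-map-rank S f sorted ⟩
    ∑< (count L S) f
      ≡⟨ cong (λ c → ∑< c f) count≡1+k ⟩
    E (suc k) (rank L S p) ∎
    where
    f : ℕ → ℕ
    f t = 2 ^ 𝟙 (t <ᵇ rank L S p) * E k t
    step : ∀ {x} → x ∈ L → (if S x then ∑perm L k (S ─ x) (λ w → 2 ^ des (p ∷ x ∷ w)) else 0)
                         ≡ (if S x then f (rank L S x) else 0)
    step {x} x∈L with S x in Sx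
    ... | false = refl
    ... | true  = begin
      ∑perm L k (S ─ x) (λ w → 2 ^ des (p ∷ x ∷ w))
        ≡⟨ ∑perm-cong L k (S ─ x) (λ w → ^-distribˡ-+-* 2 (𝟙 (x <ᵇ p)) (des (x ∷ w))) ⟩
      ∑perm L k (S ─ x) (λ w → 2 ^ 𝟙 (x <ᵇ p) * 2 ^ des (x ∷ w))
        ≡⟨ ∑perm-*ˡ L k (S ─ x) (2 ^ 𝟙 (x <ᵇ p)) (λ w → 2 ^ des (x ∷ w)) ⟩
      2 ^ 𝟙 (x <ᵇ p) * ∑perm L k (S ─ x) (λ w → 2 ^ des (x ∷ w))
        ≡⟨ cong₂ (λ b e → 2 ^ 𝟙 b * e) (rank-<ᵇ S x∈L Sx Sp) (∑perm-des k (S ─ x) x count′ (─-self S x)) ⟩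
      2 ^ 𝟙 (rank L S x <ᵇ rank L S p) * E k (rank L (S ─ x) x)
        ≡⟨ cong (λ r → 2 ^ 𝟙 (rank L S x <ᵇ rank L S p) * E k r) (rank-─ L S x) ⟩
      f (rank L S x) ∎
      where
      count′ : count L (S ─ x) ≡ k
      count′ = suc-injective (trans (sym (count-─-at S x∈L Sx)) count≡1+k)

  ∑perm-climbWeight-top : ∀ {m} k S → All (_≤ m) L → count L (S ─ m) ≡ k →
                          ∑perm L k (S ─ m) (climbWeight m m) ≡ E k k
  ∑perm-climbWeight-top {m} k S L≤m count≡k = begin
    ∑perm L k (S ─ m) (climbWeight m m)         ≡⟨ ∑perm-cong L k (S ─ m) (climbWeight-top m) ⟩
    ∑perm L k (S ─ m) (λ w → 2 ^ des (m ∷ w))   ≡⟨ ∑perm-des k (S ─ m) m count≡k (─-self S m) ⟩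
    E k (rank L (S ─ m) m)                      ≡⟨ cong (E k) (trans (rank-top (S ─ m) L≤m (─-self S m)) count≡k) ⟩
    E k k                                       ∎

  ∑perm-climbWeight : ∀ {m} → All (_≤ m) L → m ∈ L → ∀ k S p → count L S ≡ k → S m ≡ true → p < m →
                      ∑perm L k S (climbWeight m p) ≡ Φ k (corank L S p)
  ∑perm-climbWeight         L≤m m∈L zero    S p _         _  _   = refl
  ∑perm-climbWeight {m} L≤m m∈L (suc k) S p count≡1+k Sm p<m =
    trans (sum-map-cong L step) (sum-map-corank S p (Ψ k) sorted)
    where
    step : ∀ {x} → x ∈ L → (if S x then ∑perm L k (S ─ x) (climbWeight m p ∘ (x ∷_)) else 0)
                         ≡ (if S x ∧ (p <ᵇ x) then Ψ k (corank L S x) else 0)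
    step {x} x∈L with S x in Sx
    ... | false = refl
    ... | true  = by-comparison (p <ᵇ x) refl
      where
      count′ : count L (S ─ x) ≡ k
      count′ = suc-injective (trans (sym (count-─-at S x∈L Sx)) count≡1+k)
      continue : x < m ⊎ x ≡ m → ∑perm L k (S ─ x) (climbWeight m x) ≡ Ψ k (corank L S x)
      continue (inj₂ refl) = trans (∑perm-climbWeight-top k S L≤m count′) (cong (Ψ k) (sym (corank-top S L≤m)))
      continue (inj₁ x<m)  = begin
        ∑perm L k (S ─ x) (climbWeight m x)   ≡⟨ ∑perm-climbWeight L≤m m∈L k (S ─ x) x count′ (trans (─-≢ S (>⇒≢ x<m)) Sm) x<m ⟩
        Φ k (corank L (S ─ x) x)              ≡⟨ cong (Φ k) (corank-─ L S x) ⟩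
        Φ k (corank L S x)                    ≡⟨ Φ≡Ψ k (corank-pos S m∈L Sm x<m) ⟩
        Ψ k (corank L S x)                    ∎
      by-comparison : ∀ b → (p <ᵇ x) ≡ b →
                      ∑perm L k (S ─ x) (climbWeight m p ∘ (x ∷_)) ≡ (if b then Ψ k (corank L S x) else 0)
      by-comparison false p≮x  = trans (∑perm-cong L k (S ─ x) (λ w → climbWeight-descent w p<m p≮x))
                                       (∑perm-zero L k (S ─ x))
      by-comparison true  p<ᵇx = trans (∑perm-cong L k (S ─ x) (λ w → climbWeight-ascent w p<m p<ᵇx))
                                       (continue (m≤n⇒m<n∨m≡n (All.lookup L≤m x∈L)))

a≡Φ : ∀ n → a n ≡ Φ (suc n) (suc n)
a≡Φ n = begin
  a n                                                         ≡⟨ sum-map-filterᵇ (incUpTo m) _ (perms m) ⟩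
  sum (map weight (perms m))                                  ≡⟨ sum-map-filterᵇ (isPermWord m) weight (words m m) ⟩
  sum (map (λ w → if isPermWord m w then weight w else 0) (words m m))
                                                              ≡⟨ sum-words m m _ ⟩
  ∑words m R (λ w → if covers R all w then weight w else 0)   ≡⟨ ∑words-covering sorted m all weight count-all-R ⟩
  ∑perm R m all weight                                        ≡⟨ sum-map-cong R prepend-sentinel ⟩
  ∑perm R m all (climbWeight m 0)                             ≡⟨ ∑perm-climbWeight sorted R≤m m∈R m all 0 count-all-R refl (s≤s z≤n) ⟩
  Φ m (corank R all 0)                                        ≡⟨ cong (Φ m) (trans (corank-below all R>0) count-all-R) ⟩
  Φ m m                                                       ∎
  where
  m : ℕ
  m = suc n
  R : List ℕ
  R = range1 m
  all : ℕ → Bool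
  all _ = true
  weight : List ℕ → ℕ
  weight w = if incUpTo m w then 2 ^ des w else 0
  sorted : AllPairs _<_ R
  sorted = AllPairs.applyUpTo⁺₁ suc m (λ i<j _ → s≤s i<j)
  R≤m : All (_≤ m) R
  R≤m = All.applyUpTo⁺₁ suc m (λ i<m → i<m)
  R>0 : All (0 <_) R
  R>0 = All.applyUpTo⁺₂ suc m (λ _ → s≤s z≤n)
  m∈R : m ∈ R
  m∈R = ∈-applyUpTo⁺ suc (n<1+n n)
  count-all-R : count R all ≡ m
  count-all-R = trans (count-all {q = all} (All.applyUpTo⁺₂ suc m (λ _ → refl))) (length-applyUpTo suc m)
  -- The sentinel 0 lies below every letter of R: it adds no descent and leaves incUpTo unchanged.
  prepend-sentinel : ∀ {x} → x ∈ R → (if all x then ∑perm R n (all ─ x) (weight ∘ (x ∷_)) else 0)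
                                    ≡ (if all x then ∑perm R n (all ─ x) (climbWeight m 0 ∘ (x ∷_)) else 0)
  prepend-sentinel {x} x∈R with ∈-applyUpTo⁻ {A = ℕ} suc {x} {m} x∈R
  ... | _ , _ , refl = refl

-- The recurrence holds for n = 0 as well.
corollary2p13 : ∀ (n : ℕ) → 1 ≤ n →
    a n ≡ sum (map (λ j → (n C j) * a (n ∸ j)) (range1 n)) + 2 ^ n
corollary2p13 n _ = begin
  a n                                                       ≡⟨ binomial-recurrence a (λ k → E k k) a+1≡2E E-diag-binomial n ⟩
  ∑[ j < n ] (n C suc j) * a (n ∸ suc j) + 2 ^ n            ≡⟨ cong (_+ 2 ^ n) (sym (sum-map-applyUpTo _ suc n)) ⟩
  sum (map (λ j → (n C j) * a (n ∸ j)) (range1 n)) + 2 ^ n  ∎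
  where
  a+1≡2E : ∀ k → a k + 1 ≡ 2 * E k k
  a+1≡2E k = trans (cong (_+ 1) (a≡Φ k)) (Φ-diag k)
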